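{- Fix $\epsilon<1/40$. Let $G$ be a graph, $P=K_3\times G$, and $H$ be $\epsilon$-near $P$ via bijection $\psi$, and let $C$ be the candidate edge graph of $H$ (with parameter $\epsilon$). Then for every $g\in V(G)$, every pair of distinct vertices in $\psi^{ -1}(\{a,b,c\}\times\{g\})$ is an edge of $C$.
   Context: Graphs are finite, undirected, simple, loopless. $\Gamma_X(v)$ is the neighbourhood of $v$ in $X$, $I_X(u,v)=\Gamma_X(u)\cap\Gamma_X(v)$. The tensor product $F\times G$ has vertex set $V(F)\times V(G)$, with $(f,g)$, $(f',g')$ adjacent iff $\{f,f'\}\in E(F)$ and $\{g,g'\}\in E(G)$. $K_3$ is the complete graph on $\{a,b,c\}$. $H$ is $\epsilon$-near $P=K_3\times G$ means: there is $E'\subseteq E(P)$ such that each vertex $w$ of $P$ has at most $\epsilon|\Gamma_P(w)|$ incident edges in $E'$, and a bijection $\psi:V(H)\to V(P)$ which is a graph isomorphism from $H$ onto $(V(P),E(P)\setminus E')$. The candidate edge graph $C$ has vertex set $V(H)$; distinct $u,v$ with $|\Gamma_H(u)|\ge|\Gamma_H(v)|$ are adjacent in $C$ iff (i) $|\Gamma_H(u)|-|\Gamma_H(v)|\le 2\epsilon|\Gamma_H(u)|$, and (ii) $(1-6\epsilon)\frac{|\Gamma_H(u)|}{2}\le|I_H(u,v)|\le\frac{1}{1-\epsilon}\cdot\frac{|\Gamma_H(u)|}{2}$. -}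

module Defs where

open import Data.Bool using (Bool; true; false; _∧_; not)
open import Data.Nat as ℕ using (ℕ; zero; suc)
open import Data.Fin as Fin using (Fin)
open import Data.List using (List; []; _∷_; allFin; cartesianProduct)
open import Data.Product using (_×_; _,_; proj₁; proj₂; Σ)
open import Data.Sum using (_⊎_)
open import Data.Integer using (+_)
open import Data.Rational as ℚ using (ℚ; 0ℚ; 1ℚ; _≤_; _<_; _-_; _*_; 1/_; ≢-nonZero)
open import Data.Rational.Properties using (_≟_)
open import Relation.Nullary using (¬_; yes; no; ⌊_⌋)
open import Relation.Binary.PropositionalEquality using (_≡_; _≢_)
open import Function.Bundles using (_⤖_; Bijection)

count : {A : Set} → List A → (A → Bool) → ℕ
count [] p = 0
count (x ∷ xs) p with p x
... | true  = suc (count xs p)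
... | false = count xs p

record Graph (V : Set) : Set where
  field
    adj    : V → V → Bool
    sym    : ∀ u v → adj u v ≡ adj v u
    irrefl : ∀ v → adj v v ≡ false
open Graph public

VP : ℕ → Set
VP m = Fin 3 × Fin m

enumP : (m : ℕ) → List (VP m)
enumP m = cartesianProduct (allFin 3) (allFin m)

-- K₃ on {a,b,c} = {0,1,2}
K3adj : Fin 3 → Fin 3 → Bool
K3adj i j = not ⌊ i Fin.≟ j ⌋

Padj : {m : ℕ} → Graph (Fin m) → VP m → VP m → Bool
Padj G (i , g) (j , h) = K3adj i j ∧ adj G g h

degP : {m : ℕ} → Graph (Fin m) → VP m → ℕ
degP {m} G w = count (enumP m) (Padj G w)

deg : {n : ℕ} → Graph (Fin n) → Fin n → ℕ
deg {n} H u = count (allFin n) (adj H u)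

common : {n : ℕ} → Graph (Fin n) → Fin n → Fin n → ℕ
common {n} H u v = count (allFin n) (λ w → adj H u w ∧ adj H v w)

ℕ→ℚ : ℕ → ℚ
ℕ→ℚ k = (+ k) ℚ./ 1

half : ℕ → ℚ
half k = (+ k) ℚ./ 2

record Near (ε : ℚ) {n m : ℕ} (G : Graph (Fin m)) (H : Graph (Fin n))
            (ψ : Fin n ⤖ VP m) : Set where
  private f = Bijection.to ψ
  field
    E'      : VP m → VP m → Bool
    E'-sym  : ∀ w w' → E' w w' ≡ E' w' w
    E'⊆P    : ∀ w w' → E' w w' ≡ true → Padj G w w' ≡ true
    E'-deg  : ∀ w → ℕ→ℚ (count (enumP m) (E' w)) ≤ ε * ℕ→ℚ (degP G w)
    iso     : ∀ u v → adj H u v ≡ (Padj G (f u) (f v) ∧ not (E' (f u) (f v)))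

-- 1/p (junk value 0 at p = 0, never used since ε < 1/40 gives 1 - ε ≠ 0)
inv : ℚ → ℚ
inv p with p ≟ 0ℚ
... | yes _ = 0ℚ
... | no ne = 1/_ p {{≢-nonZero ne}}

-- conditions (i),(ii) of the candidate edge graph, for |Γ(u)| ≥ |Γ(v)|
CandCond : ℚ → {n : ℕ} → Graph (Fin n) → Fin n → Fin n → Set
CandCond ε H u v =
  (ℕ→ℚ (deg H u) - ℕ→ℚ (deg H v) ≤ (ℕ→ℚ 2 * ε) * ℕ→ℚ (deg H u))
  × ((1ℚ - ℕ→ℚ 6 * ε) * half (deg H u) ≤ ℕ→ℚ (common H u v))
  × (ℕ→ℚ (common H u v) ≤ inv (1ℚ - ε) * half (deg H u))

CandAdj : ℚ → {n : ℕ} → Graph (Fin n) → Fin n → Fin n → Set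
CandAdj ε H u v =
  u ≢ v ×
  ((deg H v ℕ.≤ deg H u × CandCond ε H u v) ⊎
   (deg H u ℕ.< deg H v × CandCond ε H v u))

-- Write a = ψ x and b = ψ y for two vertices of H over the same g ∈ V(G), and d = |Γ_G(g)|.
-- In P = K₃ × G the vertex a has 2d neighbours, and a, b (distinct in the K₃-coordinate) have
-- exactly d common neighbours, namely the third copy of Γ_G(g). H is P with the E'-edges
-- removed; if e_x, e_y ≤ 2εd are the numbers removed at a and b, then |Γ_H(x)| = 2d - e_x and
-- d - e_x - e_y ≤ |I_H(x,y)| ≤ d. Both conditions defining C are then linear inequalities in
-- d, e_x, e_y which hold once ε < 1/40: each slack is a sum of manifestly nonnegative terms.
module Submission where

open import Defs
open import Data.Nat as ℕ using (ℕ)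
import Data.Nat.Properties as ℕ
open import Data.Fin using (Fin)
open import Data.Rational using (ℚ)
open import Data.Product using (_,_; proj₁; proj₂)
open import Data.Sum using (inj₁; inj₂)
open import Function using (_∘_)
open import Function.Bundles using (_⤖_; Bijection)
open import Relation.Binary.PropositionalEquality using (_≡_; _≢_; refl; cong; cong₂; subst; module ≡-Reasoning)
import Relation.Binary.PropositionalEquality as ≡
open import Relation.Nullary using (yes; no)

module Counting where

  open import Data.Bool using (Bool; true; false; _∧_; _∨_; not)
  open import Data.Bool.Properties using (∧-zeroʳ; _≟_)
  open import Data.Nat using (suc; _+_; _*_; _≤_; z≤n; s≤s)
  open import Data.Nat.Properties
    using (+-suc; +-identityʳ; +-mono-≤; +-monoʳ-≤; ≤-trans; ≤-reflexive; n≤1+n; m≤n⇒m≤1+n; module ≤-Reasoning)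
  import Data.Fin as Fin
  open import Data.List using (List; []; _∷_; _++_; map; filter; length; allFin; cartesianProduct)
  open import Data.List.Membership.Propositional using (_∈_)
  open import Data.List.Membership.Propositional.Properties using (∈-map⁺; ∈-allFin; ∈-cartesianProduct⁺)
  open import Data.List.Membership.Propositional.Properties.WithK using (unique∧set⇒bag)
  open import Data.List.Relation.Unary.Unique.Propositional using (Unique)
  open import Data.List.Relation.Unary.Unique.Propositional.Properties using (map⁺; allFin⁺; cartesianProduct⁺)
  open import Data.List.Relation.Binary.Permutation.Propositional using (_↭_)
  open import Data.List.Relation.Binary.Permutation.Propositional.Properties using (↭-length; filter-↭)
  open import Data.List.Relation.Binary.BagAndSetEquality using (∼bag⇒↭)
  open import Function.Bundles using (mk⇔)

  module _ {A : Set} where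

    count-ext : ∀ xs {p q : A → Bool} → (∀ x → p x ≡ q x) → count xs p ≡ count xs q
    count-ext []       p≗q = refl
    count-ext (x ∷ xs) {p} {q} p≗q with p x | q x | p≗q x
    ... | true  | true  | _ = cong suc (count-ext xs p≗q)
    ... | false | false | _ = count-ext xs p≗q

    count-false : ∀ xs → count xs (λ (_ : A) → false) ≡ 0
    count-false []       = refl
    count-false (_ ∷ xs) = count-false xs

    count-++ : ∀ xs ys (p : A → Bool) → count (xs ++ ys) p ≡ count xs p + count ys p
    count-++ []       ys p = refl
    count-++ (x ∷ xs) ys p with p x
    ... | true  = cong suc (count-++ xs ys p)
    ... | false = count-++ xs ys p

    count≡length∘filter : ∀ xs (p : A → Bool) → count xs p ≡ length (filter (λ x → p x ≟ true) xs)
    count≡length∘filter []       p = refl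
    count≡length∘filter (x ∷ xs) p with p x
    ... | true  = cong suc (count≡length∘filter xs p)
    ... | false = count≡length∘filter xs p

    count-↭ : ∀ {xs ys} → xs ↭ ys → (p : A → Bool) → count xs p ≡ count ys p
    count-↭ {xs} {ys} xs↭ys p = begin
      count xs p                             ≡⟨ count≡length∘filter xs p ⟩
      length (filter (λ x → p x ≟ true) xs)  ≡⟨ ↭-length (filter-↭ (λ x → p x ≟ true) xs↭ys) ⟩
      length (filter (λ x → p x ≟ true) ys)  ≡⟨ count≡length∘filter ys p ⟨
      count ys p                             ∎
      where open ≡-Reasoning

    count-mono : ∀ xs {p q : A → Bool} → (∀ x → p x ≡ true → q x ≡ true) → count xs p ≤ count xs q
    count-mono []       p⇒q = z≤n
    count-mono (x ∷ xs) {p} {q} p⇒q with p x | q x | p⇒q x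
    ... | true  | true  | _    = s≤s (count-mono xs p⇒q)
    ... | true  | false | p⇒qx with () ← p⇒qx refl
    ... | false | true  | _    = m≤n⇒m≤1+n (count-mono xs p⇒q)
    ... | false | false | _    = count-mono xs p⇒q

    count-∨ : ∀ xs (p q : A → Bool) → count xs (λ x → p x ∨ q x) ≤ count xs p + count xs q
    count-∨ []       p q = z≤n
    count-∨ (x ∷ xs) p q with p x | q x
    ... | true  | true  = s≤s (≤-trans (count-∨ xs p q) (+-monoʳ-≤ (count xs p) (n≤1+n (count xs q))))
    ... | true  | false = s≤s (count-∨ xs p q)
    ... | false | true  = ≤-trans (s≤s (count-∨ xs p q)) (≤-reflexive (≡.sym (+-suc (count xs p) (count xs q))))
    ... | false | false = count-∨ xs p q

    count-∧-not-+-count : ∀ xs {p e : A → Bool} → (∀ x → e x ≡ true → p x ≡ true) →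
                          count xs (λ x → p x ∧ not (e x)) + count xs e ≡ count xs p
    count-∧-not-+-count []       e⇒p = refl
    count-∧-not-+-count (x ∷ xs) {p} {e} e⇒p with p x | e x | e⇒p x
    ... | true  | true  | _    = ≡.trans (+-suc _ _) (cong suc (count-∧-not-+-count xs e⇒p))
    ... | true  | false | _    = cong suc (count-∧-not-+-count xs e⇒p)
    ... | false | true  | e⇒px with () ← e⇒px refl
    ... | false | false | _    = count-∧-not-+-count xs e⇒p

  count-map : ∀ {A B : Set} (f : A → B) xs (p : B → Bool) → count (map f xs) p ≡ count xs (p ∘ f)
  count-map f []       p = refl
  count-map f (x ∷ xs) p with p (f x)
  ... | true  = cong suc (count-map f xs p)
  ... | false = count-map f xs p

  count-cartesianProduct : ∀ {A B : Set} xs ys (p : A → Bool) (q : B → Bool) →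
    count (cartesianProduct xs ys) (λ w → p (proj₁ w) ∧ q (proj₂ w)) ≡ count xs p * count ys q
  count-cartesianProduct []       ys p q = refl
  count-cartesianProduct (x ∷ xs) ys p q with p x in px
  ... | true  = ≡.trans (count-++ (map (x ,_) ys) (cartesianProduct xs ys) _)
    (cong₂ _+_ (≡.trans (count-map (x ,_) ys _) (count-ext ys λ y → cong (_∧ q y) px))
               (count-cartesianProduct xs ys p q))
  ... | false = ≡.trans (count-++ (map (x ,_) ys) (cartesianProduct xs ys) _)
    (cong₂ _+_ (≡.trans (count-map (x ,_) ys _) (≡.trans (count-ext ys λ y → cong (_∧ q y) px) (count-false ys)))
               (count-cartesianProduct xs ys p q))

  count-⤖ : ∀ {n} {A : Set} (ψ : Fin n ⤖ A) {xs : List A} → Unique xs → (∀ a → a ∈ xs) →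
            ∀ p → count (allFin n) (p ∘ Bijection.to ψ) ≡ count xs p
  count-⤖ {n} ψ {xs} xs! ∈xs p = ≡.trans (≡.sym (count-map to (allFin n) p)) (count-↭ images↭xs p)
    where
    open Bijection ψ using (to; injective; strictlySurjective)
    ∈images : ∀ a → a ∈ map to (allFin n)
    ∈images a with i , to-i≡a ← strictlySurjective a =
      subst (_∈ map to (allFin n)) to-i≡a (∈-map⁺ to (∈-allFin i))
    images↭xs : map to (allFin n) ↭ xs
    images↭xs = ∼bag⇒↭ (unique∧set⇒bag (map⁺ injective (allFin⁺ n)) xs!
                                        (mk⇔ (λ _ → ∈xs _) (λ _ → ∈images _)))

  ∈-enumP : ∀ {m} (w : VP m) → w ∈ enumP m
  ∈-enumP (i , g) = ∈-cartesianProduct⁺ (∈-allFin i) (∈-allFin g)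

  enumP-unique : ∀ m → Unique (enumP m)
  enumP-unique m = cartesianProduct⁺ (allFin⁺ 3) (allFin⁺ m)

  K3-degree : ∀ i → count (allFin 3) (K3adj i) ≡ 2
  K3-degree Fin.zero                     = refl
  K3-degree (Fin.suc Fin.zero)           = refl
  K3-degree (Fin.suc (Fin.suc Fin.zero)) = refl

  K3-common : ∀ {i j} → i ≢ j → count (allFin 3) (λ k → K3adj i k ∧ K3adj j k) ≡ 1
  K3-common {Fin.zero}                     {Fin.zero}                     i≢j with () ← i≢j refl
  K3-common {Fin.zero}                     {Fin.suc Fin.zero}             _   = refl
  K3-common {Fin.zero}                     {Fin.suc (Fin.suc Fin.zero)}   _   = refl
  K3-common {Fin.suc Fin.zero}             {Fin.zero}                     _   = refl
  K3-common {Fin.suc Fin.zero}             {Fin.suc Fin.zero}             i≢j with () ← i≢j refl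
  K3-common {Fin.suc Fin.zero}             {Fin.suc (Fin.suc Fin.zero)}   _   = refl
  K3-common {Fin.suc (Fin.suc Fin.zero)}   {Fin.zero}                     _   = refl
  K3-common {Fin.suc (Fin.suc Fin.zero)}   {Fin.suc Fin.zero}             _   = refl
  K3-common {Fin.suc (Fin.suc Fin.zero)}   {Fin.suc (Fin.suc Fin.zero)}   i≢j with () ← i≢j refl

  degP-≡ : ∀ {m} (G : Graph (Fin m)) i g → degP G (i , g) ≡ deg G g + deg G g
  degP-≡ {m} G i g = begin
    degP G (i , g)                         ≡⟨ count-cartesianProduct (allFin 3) (allFin m) (K3adj i) (adj G g) ⟩
    count (allFin 3) (K3adj i) * deg G g   ≡⟨ cong (_* deg G g) (K3-degree i) ⟩
    deg G g + (deg G g + 0)                ≡⟨ cong (deg G g +_) (+-identityʳ (deg G g)) ⟩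
    deg G g + deg G g                      ∎
    where open ≡-Reasoning

  commonP : ∀ {m} → Graph (Fin m) → VP m → VP m → ℕ
  commonP {m} G a b = count (enumP m) (λ w → Padj G a w ∧ Padj G b w)

  ∧-∧-shared : ∀ x y z → (x ∧ z) ∧ (y ∧ z) ≡ (x ∧ y) ∧ z
  ∧-∧-shared true  y true  = refl
  ∧-∧-shared true  y false = ≡.sym (∧-zeroʳ y)
  ∧-∧-shared false y z     = refl

  commonP-≡ : ∀ {m} (G : Graph (Fin m)) {a b} → proj₁ a ≢ proj₁ b → proj₂ a ≡ proj₂ b →
              commonP G a b ≡ deg G (proj₂ a)
  commonP-≡ {m} G {i , g} {j , .g} i≢j refl = begin
    commonP G (i , g) (j , g)
      ≡⟨ count-ext (enumP m) (λ w → ∧-∧-shared (K3adj i (proj₁ w)) (K3adj j (proj₁ w)) (adj G g (proj₂ w))) ⟩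
    count (enumP m) (λ w → (K3adj i (proj₁ w) ∧ K3adj j (proj₁ w)) ∧ adj G g (proj₂ w))
      ≡⟨ count-cartesianProduct (allFin 3) (allFin m) _ (adj G g) ⟩
    count (allFin 3) (λ k → K3adj i k ∧ K3adj j k) * deg G g
      ≡⟨ cong (_* deg G g) (K3-common i≢j) ⟩
    deg G g + 0
      ≡⟨ +-identityʳ (deg G g) ⟩
    deg G g ∎
    where open ≡-Reasoning

  kept∧kept⇒adj∧adj : ∀ p e q e′ → (p ∧ not e) ∧ (q ∧ not e′) ≡ true → p ∧ q ≡ true
  kept∧kept⇒adj∧adj true  false true  false _ = refl
  kept∧kept⇒adj∧adj false _     _     _     ()
  kept∧kept⇒adj∧adj true  true  _     _     ()
  kept∧kept⇒adj∧adj true  false false _     ()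
  kept∧kept⇒adj∧adj true  false true  true  ()

  adj∧adj⇒kept∧kept∨removed : ∀ p e q e′ → p ∧ q ≡ true → ((p ∧ not e) ∧ (q ∧ not e′)) ∨ (e ∨ e′) ≡ true
  adj∧adj⇒kept∧kept∨removed true  false true  false _ = refl
  adj∧adj⇒kept∧kept∨removed true  false true  true  _ = refl
  adj∧adj⇒kept∧kept∨removed true  true  true  _     _ = refl
  adj∧adj⇒kept∧kept∨removed true  _     false _     ()
  adj∧adj⇒kept∧kept∨removed false _     _     _     ()

  module NearCounts {ε : ℚ} {n m} {G : Graph (Fin m)} {H : Graph (Fin n)} {ψ : Fin n ⤖ VP m}
                    (near : Near ε G H ψ) where

    open Near near
    open Bijection ψ using (to; injective)

    removed : Fin n → ℕ
    removed x = count (enumP m) (E' (to x))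

    kept : VP m → VP m → Bool
    kept a w = Padj G a w ∧ not (E' a w)

    count-along-ψ : ∀ p → count (allFin n) (p ∘ to) ≡ count (enumP m) p
    count-along-ψ = count-⤖ ψ (enumP-unique m) ∈-enumP

    deg-+-removed : ∀ x → deg H x + removed x ≡ degP G (to x)
    deg-+-removed x = begin
      deg H x + removed x                        ≡⟨ cong (_+ removed x) deg≡ ⟩
      count (enumP m) (kept (to x)) + removed x  ≡⟨ count-∧-not-+-count (enumP m) (E'⊆P (to x)) ⟩
      degP G (to x)                              ∎
      where
      open ≡-Reasoning
      deg≡ : deg H x ≡ count (enumP m) (kept (to x))
      deg≡ = ≡.trans (count-ext (allFin n) (iso x)) (count-along-ψ (kept (to x)))

    common-≡ : ∀ x y → common H x y ≡ count (enumP m) (λ w → kept (to x) w ∧ kept (to y) w)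
    common-≡ x y = ≡.trans (count-ext (allFin n) (λ w → cong₂ _∧_ (iso x w) (iso y w)))
                           (count-along-ψ (λ w → kept (to x) w ∧ kept (to y) w))

    common-≤-commonP : ∀ x y → common H x y ≤ commonP G (to x) (to y)
    common-≤-commonP x y = subst (_≤ commonP G (to x) (to y)) (≡.sym (common-≡ x y))
      (count-mono (enumP m) λ w → kept∧kept⇒adj∧adj (Padj G (to x) w) (E' (to x) w) (Padj G (to y) w) (E' (to y) w))

    commonP-≤-common+removed : ∀ x y → commonP G (to x) (to y) ≤ common H x y + (removed x + removed y)
    commonP-≤-common+removed x y = begin
      commonP G a b
        ≤⟨ count-mono (enumP m) (λ w → adj∧adj⇒kept∧kept∨removed (Padj G a w) (E' a w) (Padj G b w) (E' b w)) ⟩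
      count (enumP m) (λ w → (kept a w ∧ kept b w) ∨ (E' a w ∨ E' b w))
        ≤⟨ count-∨ (enumP m) _ _ ⟩
      count (enumP m) (λ w → kept a w ∧ kept b w) + count (enumP m) (λ w → E' a w ∨ E' b w)
        ≤⟨ +-mono-≤ (≤-reflexive (≡.sym (common-≡ x y))) (count-∨ (enumP m) (E' a) (E' b)) ⟩
      common H x y + (removed x + removed y) ∎
      where
      open ≤-Reasoning
      a = to x
      b = to y

    degP-over : ∀ {z g} → proj₂ (to z) ≡ g → degP G (to z) ≡ deg G g + deg G g
    degP-over {z} refl = degP-≡ G (proj₁ (to z)) (proj₂ (to z))

    deg-+-removed-over : ∀ {z g} → proj₂ (to z) ≡ g → deg H z + removed z ≡ deg G g + deg G g
    deg-+-removed-over {z} z∈g = ≡.trans (deg-+-removed z) (degP-over z∈g)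

    commonP-over : ∀ {x y g} → x ≢ y → proj₂ (to x) ≡ g → proj₂ (to y) ≡ g → commonP G (to x) (to y) ≡ deg G g
    commonP-over x≢y refl y∈g = commonP-≡ G (λ i≡j → x≢y (injective (cong₂ _,_ i≡j (≡.sym y∈g)))) (≡.sym y∈g)

open Counting using (commonP; module NearCounts)

open import Data.Integer using (+_)
open import Data.Rational
open import Data.Rational.Properties
open import Data.Rational.Solver using (module +-*-Solver)
import Data.Rational.Unnormalised as ℚᵘ
import Data.Rational.Unnormalised.Properties as ℚᵘ
import Data.Integer as ℤ
import Data.Integer.Solver as ℤ-Solver
open import Data.Empty using (⊥-elim-irr)
open import Algebra.Properties.Group +-0-group using (quasigroup)
open import Algebra.Properties.Quasigroup quasigroup using (x≈z//y)

private
  toℚᵘ-ℕ→ℚ : ∀ k → toℚᵘ (ℕ→ℚ k) ℚᵘ.≃ ℚᵘ.mkℚᵘ (+ k) 0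
  toℚᵘ-ℕ→ℚ k = toℚᵘ-fromℚᵘ (ℚᵘ.mkℚᵘ (+ k) 0)

ℕ→ℚ-+ : ∀ a b → ℕ→ℚ (a ℕ.+ b) ≡ ℕ→ℚ a + ℕ→ℚ b
ℕ→ℚ-+ a b = toℚᵘ-injective (begin
  toℚᵘ (ℕ→ℚ (a ℕ.+ b))                  ≈⟨ toℚᵘ-ℕ→ℚ (a ℕ.+ b) ⟩
  ℚᵘ.mkℚᵘ (+ a ℤ.+ + b) 0               ≈⟨ ℚᵘ.*≡* (lemma (+ a) (+ b)) ⟩
  ℚᵘ.mkℚᵘ (+ a) 0 ℚᵘ.+ ℚᵘ.mkℚᵘ (+ b) 0  ≈⟨ ℚᵘ.+-cong (toℚᵘ-ℕ→ℚ a) (toℚᵘ-ℕ→ℚ b) ⟨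
  toℚᵘ (ℕ→ℚ a) ℚᵘ.+ toℚᵘ (ℕ→ℚ b)        ≈⟨ toℚᵘ-homo-+ (ℕ→ℚ a) (ℕ→ℚ b) ⟨
  toℚᵘ (ℕ→ℚ a + ℕ→ℚ b)                  ∎)
  where
  open ℚᵘ.≃-Reasoning
  open ℤ-Solver.+-*-Solver
  lemma : ∀ x y → (x ℤ.+ y) ℤ.* + 1 ≡ (x ℤ.* + 1 ℤ.+ y ℤ.* + 1) ℤ.* + 1
  lemma = solve 2 (λ x y → (x :+ y) :* con (+ 1) := (x :* con (+ 1) :+ y :* con (+ 1)) :* con (+ 1)) refl

half≡ℕ→ℚ*½ : ∀ k → half k ≡ ℕ→ℚ k * ½
half≡ℕ→ℚ*½ k = toℚᵘ-injective (begin
  toℚᵘ (half k)                ≈⟨ toℚᵘ-fromℚᵘ (ℚᵘ.mkℚᵘ (+ k) 1) ⟩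
  ℚᵘ.mkℚᵘ (+ k) 1              ≈⟨ ℚᵘ.*≡* (lemma (+ k)) ⟩
  ℚᵘ.mkℚᵘ (+ k) 0 ℚᵘ.* toℚᵘ ½  ≈⟨ ℚᵘ.*-congʳ (toℚᵘ-ℕ→ℚ k) ⟨
  toℚᵘ (ℕ→ℚ k) ℚᵘ.* toℚᵘ ½     ≈⟨ toℚᵘ-homo-* (ℕ→ℚ k) ½ ⟨
  toℚᵘ (ℕ→ℚ k * ½)             ∎)
  where
  open ℚᵘ.≃-Reasoning
  open ℤ-Solver.+-*-Solver
  lemma : ∀ x → x ℤ.* + 2 ≡ (x ℤ.* + 1) ℤ.* + 2
  lemma = solve 1 (λ x → x :* con (+ 2) := (x :* con (+ 1)) :* con (+ 2)) refl

0≤ℕ→ℚ : ∀ k → 0ℚ ≤ ℕ→ℚ k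
0≤ℕ→ℚ k = nonNegative⁻¹ (ℕ→ℚ k) {{normalize-nonNeg k 1}}

ℕ→ℚ-mono-≤ : ∀ {a b} → a ℕ.≤ b → ℕ→ℚ a ≤ ℕ→ℚ b
ℕ→ℚ-mono-≤ {a} {b} a≤b = begin
  ℕ→ℚ a                  ≡⟨ +-identityʳ (ℕ→ℚ a) ⟨
  ℕ→ℚ a + 0ℚ             ≤⟨ +-monoʳ-≤ (ℕ→ℚ a) (0≤ℕ→ℚ (b ℕ.∸ a)) ⟩
  ℕ→ℚ a + ℕ→ℚ (b ℕ.∸ a)  ≡⟨ ℕ→ℚ-+ a (b ℕ.∸ a) ⟨
  ℕ→ℚ (a ℕ.+ (b ℕ.∸ a))  ≡⟨ cong ℕ→ℚ (ℕ.m+[n∸m]≡n a≤b) ⟩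
  ℕ→ℚ b                  ∎
  where open ≤-Reasoning

inv≡1/ : ∀ p .{{p≢0 : NonZero p}} → inv p ≡ 1/ p
inv≡1/ p {{p≢0}} with p ≟ 0ℚ
... | yes refl = ⊥-elim-irr (ℕ.NonZero.nonZero p≢0)
... | no  _    = refl

≤-by-gap : ∀ {a b} s → 0ℚ ≤ s → b ≡ a + s → a ≤ b
≤-by-gap {a} {b} s 0≤s b≡a+s = begin
  a       ≡⟨ +-identityʳ a ⟨
  a + 0ℚ  ≤⟨ +-monoʳ-≤ a 0≤s ⟩
  a + s   ≡⟨ b≡a+s ⟨
  b       ∎
  where open ≤-Reasoning

0≤- : ∀ {a b} → a ≤ b → 0ℚ ≤ b - a
0≤- {a} {b} a≤b = subst (_≤ b - a) (+-inverseʳ a) (+-monoˡ-≤ (- a) a≤b)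

0<- : ∀ {a b} → a < b → 0ℚ < b - a
0<- {a} {b} a<b = subst (_< b - a) (+-inverseʳ a) (+-monoˡ-< (- a) a<b)

0≤+ : ∀ {a b} → 0ℚ ≤ a → 0ℚ ≤ b → 0ℚ ≤ a + b
0≤+ {a} {b} 0≤a 0≤b = subst (_≤ a + b) (+-identityʳ 0ℚ) (+-mono-≤ 0≤a 0≤b)

0≤* : ∀ {a b} → 0ℚ ≤ a → 0ℚ ≤ b → 0ℚ ≤ a * b
0≤* {a} {b} 0≤a 0≤b =
  nonNegative⁻¹ (a * b) {{nonNeg*nonNeg⇒nonNeg a {{nonNegative 0≤a}} b {{nonNegative 0≤b}}}}

1/40 : ℚ
1/40 = + 1 / 40

-- The statement does not assume 0 ≤ ε; terms ε * e with 0 ≤ e are bounded through this instead.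
*-mono-<1/40 : ∀ {ε e} → ε < 1/40 → 0ℚ ≤ e → ε * e ≤ 1/40 * e
*-mono-<1/40 {ε} {e} ε<1/40 0≤e = *-monoʳ-≤-nonNeg e {{nonNegative 0≤e}} (<⇒≤ ε<1/40)

module _ {ε δ : ℚ} (ε<1/40 : ε < 1/40) where

  open +-*-Solver

  private
    D u : ℚ
    D = δ + δ
    u = ε * D

  degree-gap : ∀ {eˣ eʸ dˣ dʸ} → 0ℚ ≤ eˣ → eˣ ≤ u → eʸ ≤ u →
               dˣ ≡ D - eˣ → dʸ ≡ D - eʸ → dˣ - dʸ ≤ (ℕ→ℚ 2 * ε) * dˣ
  degree-gap {eˣ} {eʸ} 0≤eˣ eˣ≤u eʸ≤u refl refl = ≤-by-gap
    ((u - eʸ) + u + ℕ→ℚ 2 * (1/40 * eˣ - ε * eˣ) + (1ℚ - ℕ→ℚ 2 * 1/40) * eˣ)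
    (0≤+ (0≤+ (0≤+ (0≤- eʸ≤u) (≤-trans 0≤eˣ eˣ≤u))
              (0≤* (≤ᵇ⇒≤ {q = ℕ→ℚ 2} _) (0≤- (*-mono-<1/40 ε<1/40 0≤eˣ))))
         (0≤* (≤ᵇ⇒≤ {q = 1ℚ - ℕ→ℚ 2 * 1/40} _) 0≤eˣ))
    (solve 4 (λ ε δ eˣ eʸ → (con (ℕ→ℚ 2) :* ε) :* ((δ :+ δ) :- eˣ)
        := (((δ :+ δ) :- eˣ) :- ((δ :+ δ) :- eʸ))
           :+ (((ε :* (δ :+ δ) :- eʸ) :+ ε :* (δ :+ δ))
               :+ con (ℕ→ℚ 2) :* (con 1/40 :* eˣ :- ε :* eˣ)
               :+ (con 1ℚ :- con (ℕ→ℚ 2) :* con 1/40) :* eˣ))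
      refl ε δ eˣ eʸ)

  common-lower : ∀ {c eˣ eʸ dˣ} → 0ℚ ≤ eˣ → eˣ ≤ u → eʸ ≤ u → δ ≤ c + (eˣ + eʸ) →
                 dˣ ≡ D - eˣ → (1ℚ - ℕ→ℚ 6 * ε) * (dˣ * ½) ≤ c
  common-lower {c} {eˣ} {eʸ} 0≤eˣ eˣ≤u eʸ≤u δ≤c+e refl = ≤-by-gap
    (((c + (eˣ + eʸ)) - δ) + (u - eʸ) + (½ + ℕ→ℚ 3 * 1/40) * (u - eˣ)
       + ℕ→ℚ 3 * (1/40 * eˣ - ε * eˣ) + (+ 3 / 2 - ℕ→ℚ 3 * 1/40) * u)
    (0≤+ (0≤+ (0≤+ (0≤+ (0≤- δ≤c+e) (0≤- eʸ≤u))
                   (0≤* (≤ᵇ⇒≤ {q = ½ + ℕ→ℚ 3 * 1/40} _) (0≤- eˣ≤u)))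
              (0≤* (≤ᵇ⇒≤ {q = ℕ→ℚ 3} _) (0≤- (*-mono-<1/40 ε<1/40 0≤eˣ))))
         (0≤* (≤ᵇ⇒≤ {q = + 3 / 2 - ℕ→ℚ 3 * 1/40} _) (≤-trans 0≤eˣ eˣ≤u)))
    (solve 5 (λ ε δ c eˣ eʸ → c
        := (con 1ℚ :- con (ℕ→ℚ 6) :* ε) :* (((δ :+ δ) :- eˣ) :* con ½)
           :+ ((((c :+ (eˣ :+ eʸ)) :- δ) :+ (ε :* (δ :+ δ) :- eʸ))
               :+ (con ½ :+ con (ℕ→ℚ 3) :* con 1/40) :* (ε :* (δ :+ δ) :- eˣ)
               :+ con (ℕ→ℚ 3) :* (con 1/40 :* eˣ :- ε :* eˣ)
               :+ (con (+ 3 / 2) :- con (ℕ→ℚ 3) :* con 1/40) :* (ε :* (δ :+ δ))))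
      refl ε δ c eˣ eʸ)

  common-upper : ∀ {c eˣ dˣ} → eˣ ≤ u → c ≤ δ → dˣ ≡ D - eˣ → c ≤ inv (1ℚ - ε) * (dˣ * ½)
  common-upper {c} {eˣ} {dˣ} eˣ≤u c≤δ refl = begin
    c                 ≡⟨ 1/q*[q*c]≡c ⟨
    1/ q * (q * c)    ≤⟨ *-monoˡ-≤-nonNeg (1/ q) {{pos⇒nonNeg (1/ q) {{1/pos⇒pos q}}}} q*c≤dˣ/2 ⟩
    1/ q * (dˣ * ½)   ≡⟨ cong (_* (dˣ * ½)) (inv≡1/ q) ⟨
    inv q * (dˣ * ½)  ∎
    where
    open ≤-Reasoning
    q = 1ℚ - ε
    instance
      q>0 : Positive q
      q>0 = positive (0<- (<-≤-trans ε<1/40 (≤ᵇ⇒≤ {p = 1/40} {q = 1ℚ} _)))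
      q≢0 : NonZero q
      q≢0 = pos⇒nonZero q
    1/q*[q*c]≡c : 1/ q * (q * c) ≡ c
    1/q*[q*c]≡c = ≡.trans (≡.sym (*-assoc (1/ q) q c)) (≡.trans (cong (_* c) (*-inverseˡ q)) (*-identityˡ c))
    q*c≤dˣ/2 : q * c ≤ dˣ * ½
    q*c≤dˣ/2 = ≤-by-gap (q * (δ - c) + ½ * (u - eˣ))
      (0≤+ (0≤* (<⇒≤ (positive⁻¹ q)) (0≤- c≤δ)) (0≤* (≤ᵇ⇒≤ {q = ½} _) (0≤- eˣ≤u)))
      (solve 4 (λ ε δ c eˣ → ((δ :+ δ) :- eˣ) :* con ½
          := (con 1ℚ :- ε) :* c :+ ((con 1ℚ :- ε) :* (δ :- c) :+ con ½ :* (ε :* (δ :+ δ) :- eˣ)))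
        refl ε δ c eˣ)

module _ {ε : ℚ} (ε<1/40 : ε < 1/40) {n m} {G : Graph (Fin m)} {H : Graph (Fin n)} {ψ : Fin n ⤖ VP m}
         (near : Near ε G H ψ) where

  open Near near using (E'-deg)
  open NearCounts near
  open Bijection ψ using (to)

  candCond-over : ∀ {g x y} → x ≢ y → proj₂ (to x) ≡ g → proj₂ (to y) ≡ g → CandCond ε H x y
  candCond-over {g} {x} {y} x≢y x∈g y∈g =
      degree-gap {δ = δ} ε<1/40 (0≤ℕ→ℚ (removed x)) (removed≤ x∈g) (removed≤ y∈g) (deg≡ x∈g) (deg≡ y∈g)
    , subst (λ h → (1ℚ - ℕ→ℚ 6 * ε) * h ≤ ℕ→ℚ (common H x y)) (≡.sym (half≡ℕ→ℚ*½ (deg H x)))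
        (common-lower {δ = δ} ε<1/40 (0≤ℕ→ℚ (removed x)) (removed≤ x∈g) (removed≤ y∈g) δ≤common+removed (deg≡ x∈g))
    , subst (λ h → ℕ→ℚ (common H x y) ≤ inv (1ℚ - ε) * h) (≡.sym (half≡ℕ→ℚ*½ (deg H x)))
        (common-upper {δ = δ} ε<1/40 (removed≤ x∈g) common≤δ (deg≡ x∈g))
    where
    δ = ℕ→ℚ (deg G g)
    ℕ→ℚ-2δ : ℕ→ℚ (deg G g ℕ.+ deg G g) ≡ δ + δ
    ℕ→ℚ-2δ = ℕ→ℚ-+ (deg G g) (deg G g)

    removed≤ : ∀ {z} → proj₂ (to z) ≡ g → ℕ→ℚ (removed z) ≤ ε * (δ + δ)
    removed≤ {z} z∈g = subst (λ k → ℕ→ℚ (removed z) ≤ ε * k) (≡.trans (cong ℕ→ℚ (degP-over z∈g)) ℕ→ℚ-2δ) (E'-deg (to z))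

    deg≡ : ∀ {z} → proj₂ (to z) ≡ g → ℕ→ℚ (deg H z) ≡ (δ + δ) - ℕ→ℚ (removed z)
    deg≡ {z} z∈g = x≈z//y (ℕ→ℚ (deg H z)) (ℕ→ℚ (removed z)) (δ + δ)
      (≡.trans (≡.sym (ℕ→ℚ-+ (deg H z) (removed z))) (≡.trans (cong ℕ→ℚ (deg-+-removed-over z∈g)) ℕ→ℚ-2δ))

    common≤δ : ℕ→ℚ (common H x y) ≤ δ
    common≤δ = ℕ→ℚ-mono-≤ (subst (common H x y ℕ.≤_) (commonP-over x≢y x∈g y∈g) (common-≤-commonP x y))

    δ≤common+removed : δ ≤ ℕ→ℚ (common H x y) + (ℕ→ℚ (removed x) + ℕ→ℚ (removed y))
    δ≤common+removed = begin
      δ                                                         ≡⟨ cong ℕ→ℚ (commonP-over x≢y x∈g y∈g) ⟨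
      ℕ→ℚ (commonP G (to x) (to y))                             ≤⟨ ℕ→ℚ-mono-≤ (commonP-≤-common+removed x y) ⟩
      ℕ→ℚ (common H x y ℕ.+ (removed x ℕ.+ removed y))         ≡⟨ ℕ→ℚ-+ (common H x y) _ ⟩
      ℕ→ℚ (common H x y) + ℕ→ℚ (removed x ℕ.+ removed y)       ≡⟨ cong (λ r → ℕ→ℚ (common H x y) + r) (ℕ→ℚ-+ (removed x) (removed y)) ⟩
      ℕ→ℚ (common H x y) + (ℕ→ℚ (removed x) + ℕ→ℚ (removed y)) ∎
      where open ≤-Reasoning

proposition3p1 : (ε : ℚ) → ε < (+ 1) / 40 →
    {n m : ℕ} (G : Graph (Fin m)) (H : Graph (Fin n)) (ψ : Fin n ⤖ VP m) →
    Near ε G H ψ →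
    (g : Fin m) (u v : Fin n) → u ≢ v →
    proj₂ (Bijection.to ψ u) ≡ g → proj₂ (Bijection.to ψ v) ≡ g →
    CandAdj ε H u v
proposition3p1 ε ε<1/40 G H ψ near g u v u≢v u∈g v∈g with deg H v ℕ.≤? deg H u
... | yes v≤u = u≢v , inj₁ (v≤u , candCond-over ε<1/40 near u≢v u∈g v∈g)
... | no  v≰u = u≢v , inj₂ (ℕ.≰⇒> v≰u , candCond-over ε<1/40 near (u≢v ∘ ≡.sym) v∈g u∈g)
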